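{- Consider a 0-1 Knapsack instance with capacity $t$ and items $(w_1,p_1),\dots,(w_n,p_n)$ indexed so that $p_1/w_1\ge p_2/w_2\ge\dots\ge p_n/w_n$ (ties broken arbitrarily), with $\max_i w_i\le t$ and $w_1+\dots+w_n>t$. Let $i^*=\max\{i : w_1+\dots+w_i\le t\}$ and let $P=\{1,2,\dots,i^*\}$ be the maximal prefix solution. Then there exists an optimal knapsack solution $Q\subseteq[n]$ such that \[\mathcal{S}^*(\mathrm{weights}(P\setminus Q))\cap\mathcal{S}^*(\mathrm{weights}(Q\setminus P))=\emptyset.\] Moreover, if $p_{i^*}/w_{i^*}>p_{i^*+1}/w_{i^*+1}$, then all optimal knapsack solutions $Q$ satisfy this property.
   Context: A 0-1 Knapsack instance consists of a capacity $t\in\mathbb{Z}^+$ and items $(w_i,p_i)$ with $w_i,p_i\in\mathbb{Z}^+$; a solution is a subset $S\subseteq[n]$ with $\sum_{i\in S}w_i\le t$, and it is optimal if it maximizes $\sum_{i\in S}p_i$. For $I\subseteq[n]$, $\mathrm{weights}(I)$ denotes the multiset $\{w_i : i\in I\}$. For a multiset $X$ of integers, $\mathcal{S}^*(X)$ denotes the set of sums $\sum_{y\in Y}y$ over all non-empty sub-multisets $Y\subseteq X$. -}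

module Defs where

open import Data.Nat using (ℕ; zero; suc; _+_; _*_; _≤_; _<_; _<ᵇ_)
open import Data.Bool using (Bool; true; false; if_then_else_)
open import Data.Fin using (Fin; toℕ) renaming (zero to fzero; suc to fsuc)
open import Data.Fin.Subset using (Subset; _⊆_; _─_; Nonempty; _∈_)
open import Data.Vec using ([]; _∷_; tabulate)
open import Data.Product using (Σ; _×_; ∃)
open import Relation.Nullary using (¬_)
open import Relation.Binary.PropositionalEquality using (_≡_)

sumOver : ∀ {n} → (Fin n → ℕ) → Subset n → ℕ
sumOver {zero}  f []      = 0
sumOver {suc n} f (b ∷ s) = (if b then f fzero else 0) + sumOver (λ i → f (fsuc i)) s

-- the prefix {0, …, k-1} (0-based; paper's {1, …, k})
prefix : ∀ {n} → ℕ → Subset n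
prefix k = tabulate (λ i → toℕ i <ᵇ k)

Feasible : ∀ {n} → (w : Fin n → ℕ) → ℕ → Subset n → Set
Feasible w t S = sumOver w S ≤ t

Optimal : ∀ {n} → (w p : Fin n → ℕ) → ℕ → Subset n → Set
Optimal {n} w p t Q = Feasible w t Q × (∀ (R : Subset n) → Feasible w t R → sumOver p R ≤ sumOver p Q)

-- s ∈ S*(weights(I)): s is the sum of a non-empty sub-multiset of weights(I),
-- i.e. the weight of a non-empty set of indices J ⊆ I
InSubsetSums : ∀ {n} → (w : Fin n → ℕ) → Subset n → ℕ → Set
InSubsetSums {n} w I s = Σ (Subset n) λ J → J ⊆ I × Nonempty J × sumOver w J ≡ s

DisjointSubsetSums : ∀ {n} → (w : Fin n → ℕ) → Subset n → Subset n → Set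
DisjointSubsetSums w I J = ∀ s → ¬ (InSubsetSums w I s × InSubsetSums w J s)

SortedByEfficiency : ∀ {n} → (w p : Fin n → ℕ) → Set
SortedByEfficiency {n} w p = ∀ (i j : Fin n) → toℕ i ≤ toℕ j → p j * w i ≤ p i * w j

IsIStar : ∀ {n} → (w : Fin n → ℕ) → ℕ → ℕ → Set
IsIStar {n} w t k = k ≤ n × sumOver w (prefix {n} k) ≤ t
  × (∀ j → j ≤ n → sumOver w (prefix {n} j) ≤ t → j ≤ k)

-- Suppose an optimal Q has index sets In ⊆ P ∖ Q and Out ⊆ Q ∖ P of equal total
-- weight. Every item of In precedes every item of Out in the efficiency order, so
-- In is at least as profitable as Out, and swapping them, Q′ = (Q ∖ Out) ∪ In, gives
-- a solution of the same weight and at least the same profit that shares strictly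
-- more items with P. An optimal solution sharing the most items with P therefore has
-- no such pair. If the efficiency drops strictly between items i* and i* + 1, the
-- swap strictly increases the profit, so no optimal solution has such a pair.
module Submission where

open import Defs
open import Data.Nat using (ℕ; zero; suc; _+_; _*_; _≤_; _<_; _≤?_; z≤n; s≤s; z<s; >-nonZero)
open import Data.Nat.Properties
open import Data.Bool.Properties using (T-≡)
open import Data.Fin using (Fin; toℕ; fromℕ<) renaming (zero to fzero; suc to fsuc)
open import Data.Fin.Properties using (toℕ-fromℕ<)
open import Data.Fin.Subset
  using (Subset; inside; outside; _∈_; _∉_; _⊆_; _⊂_; _∩_; _∪_; _─_; ⊤; ⊥; ∣_∣; Nonempty)
open import Data.Fin.Subset.Properties
  using (drop-there; drop-∷-⊆; x∈p∩q⁺; x∈p∩q⁻; p⊆p∪q; q⊆p∪q; p⊂q⇒∣p∣<∣q∣)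
open import Data.Vec.Base using ([]; _∷_; here; there)
open import Data.Vec.Properties using (lookup∘tabulate; []=⇒lookup; lookup⇒[]=)
open import Data.Empty using (⊥-elim)
open import Data.Product using (Σ; ∃; _×_; _,_; proj₁; proj₂)
open import Function using (Equivalence)
open import Relation.Nullary using (Dec; yes; no; contradiction)
open import Relation.Nullary.Decidable using (_×-dec_)
open import Relation.Unary using (Pred; Decidable)
open import Relation.Binary.PropositionalEquality
  using (_≡_; refl; sym; trans; cong; subst; subst₂)
import Algebra.Properties.CommutativeSemigroup as CommSemigroupProperties

open CommSemigroupProperties +-commutativeSemigroup using () renaming (x∙yz≈y∙xz to m+[n+o]≡n+[m+o])
open CommSemigroupProperties *-commutativeSemigroup using () renaming (xy∙z≈xz∙y to m*n*o≡m*o*n)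

sumOver-⊥ : ∀ {n} (f : Fin n → ℕ) → sumOver f ⊥ ≡ 0
sumOver-⊥ {zero}  f = refl
sumOver-⊥ {suc n} f = sumOver-⊥ (λ i → f (fsuc i))

sumOver-mono : ∀ {n} {f g : Fin n → ℕ} (J : Subset n)
  → (∀ {i} → i ∈ J → f i ≤ g i) → sumOver f J ≤ sumOver g J
sumOver-mono []            f≤g = z≤n
sumOver-mono (inside  ∷ J) f≤g = +-mono-≤ (f≤g here) (sumOver-mono J (λ i∈J → f≤g (there i∈J)))
sumOver-mono (outside ∷ J) f≤g = sumOver-mono J (λ i∈J → f≤g (there i∈J))

sumOver-pos : ∀ {n} {f : Fin n → ℕ} {J : Subset n} {i : Fin n}
  → i ∈ J → 0 < f i → 0 < sumOver f J
sumOver-pos {J = inside ∷ J} here        0<fi = <-≤-trans 0<fi (m≤m+n _ _)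
sumOver-pos {J = s ∷ J}      (there i∈J) 0<fi = <-≤-trans (sumOver-pos i∈J 0<fi) (m≤n+m _ _)

*-distribˡ-sumOver : ∀ {n} x (f : Fin n → ℕ) (J : Subset n)
  → x * sumOver f J ≡ sumOver (λ i → x * f i) J
*-distribˡ-sumOver x f []            = *-zeroʳ x
*-distribˡ-sumOver x f (inside  ∷ J) =
  trans (*-distribˡ-+ x (f fzero) _) (cong (x * f fzero +_) (*-distribˡ-sumOver x _ J))
*-distribˡ-sumOver x f (outside ∷ J) = *-distribˡ-sumOver x _ J

*-distribʳ-sumOver : ∀ {n} x (f : Fin n → ℕ) (J : Subset n)
  → sumOver f J * x ≡ sumOver (λ i → f i * x) J
*-distribʳ-sumOver x f []            = refl
*-distribʳ-sumOver x f (inside  ∷ J) =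
  trans (*-distribʳ-+ x (f fzero) _) (cong (f fzero * x +_) (*-distribʳ-sumOver x _ J))
*-distribʳ-sumOver x f (outside ∷ J) = *-distribʳ-sumOver x _ J

sumOver-∪ : ∀ {n} (f : Fin n → ℕ) {X Y : Subset n}
  → (∀ {i} → i ∈ X → i ∉ Y) → sumOver f (X ∪ Y) ≡ sumOver f X + sumOver f Y
sumOver-∪ f {[]}          {[]}          X∩Y≡∅ = refl
sumOver-∪ f {inside  ∷ X} {inside  ∷ Y} X∩Y≡∅ = ⊥-elim (X∩Y≡∅ here here)
sumOver-∪ f {inside  ∷ X} {outside ∷ Y} X∩Y≡∅ =
  trans (cong (f fzero +_) (sumOver-∪ _ (λ i∈X i∈Y → X∩Y≡∅ (there i∈X) (there i∈Y))))
        (sym (+-assoc (f fzero) (sumOver (λ i → f (fsuc i)) X) _))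
sumOver-∪ f {outside ∷ X} {inside  ∷ Y} X∩Y≡∅ =
  trans (cong (f fzero +_) (sumOver-∪ _ (λ i∈X i∈Y → X∩Y≡∅ (there i∈X) (there i∈Y))))
        (m+[n+o]≡n+[m+o] (f fzero) (sumOver (λ i → f (fsuc i)) X) _)
sumOver-∪ f {outside ∷ X} {outside ∷ Y} X∩Y≡∅ =
  sumOver-∪ _ (λ i∈X i∈Y → X∩Y≡∅ (there i∈X) (there i∈Y))

sumOver-─ : ∀ {n} (f : Fin n → ℕ) {X Y : Subset n}
  → Y ⊆ X → sumOver f X ≡ sumOver f (X ─ Y) + sumOver f Y
sumOver-─ f {[]}          {[]}          Y⊆X = refl
sumOver-─ f {inside  ∷ X} {inside  ∷ Y} Y⊆X =
  trans (cong (f fzero +_) (sumOver-─ _ (drop-∷-⊆ Y⊆X)))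
        (m+[n+o]≡n+[m+o] (f fzero) (sumOver (λ i → f (fsuc i)) (X ─ Y)) _)
sumOver-─ f {inside  ∷ X} {outside ∷ Y} Y⊆X =
  trans (cong (f fzero +_) (sumOver-─ _ (drop-∷-⊆ Y⊆X)))
        (sym (+-assoc (f fzero) (sumOver (λ i → f (fsuc i)) (X ─ Y)) _))
sumOver-─ f {outside ∷ X} {inside  ∷ Y} Y⊆X = contradiction (Y⊆X here) λ ()
sumOver-─ f {outside ∷ X} {outside ∷ Y} Y⊆X = sumOver-─ _ (drop-∷-⊆ Y⊆X)

x∈p─q⁻ : ∀ {n} (p q : Subset n) {x : Fin n} → x ∈ p ─ q → x ∈ p × x ∉ q
x∈p─q⁻ (inside  ∷ p) (outside ∷ q) here = here , λ ()
x∈p─q⁻ (inside  ∷ p) (inside  ∷ q) {fzero} ()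
x∈p─q⁻ (outside ∷ p) (outside ∷ q) {fzero} ()
x∈p─q⁻ (outside ∷ p) (inside  ∷ q) {fzero} ()
x∈p─q⁻ (s ∷ p) (t ∷ q) (there x∈p─q) with x∈p─q⁻ p q x∈p─q
... | x∈p , x∉q = there x∈p , λ x∈tq → x∉q (drop-there x∈tq)

x∈p─q⁺ : ∀ {n} {p q : Subset n} {x : Fin n} → x ∈ p → x ∉ q → x ∈ p ─ q
x∈p─q⁺ {q = inside  ∷ q} here x∉q = contradiction here x∉q
x∈p─q⁺ {q = outside ∷ q} here x∉q = here
x∈p─q⁺ {q = t ∷ q} (there x∈p) x∉q = there (x∈p─q⁺ x∈p (λ x∈q → x∉q (there x∈q)))

∈-prefix⁺ : ∀ {n k} {i : Fin n} → toℕ i < k → i ∈ prefix k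
∈-prefix⁺ {i = i} i<k =
  lookup⇒[]= i _ (trans (lookup∘tabulate _ i) (Equivalence.to T-≡ (<⇒<ᵇ i<k)))

∈-prefix⁻ : ∀ {n k} {i : Fin n} → i ∈ prefix k → toℕ i < k
∈-prefix⁻ {k = k} {i} i∈P =
  <ᵇ⇒< (toℕ i) k (Equivalence.from T-≡ (trans (sym (lookup∘tabulate _ i)) ([]=⇒lookup i∈P)))

∉-prefix⁻ : ∀ {n k} {i : Fin n} → i ∉ prefix k → k ≤ toℕ i
∉-prefix⁻ i∉P = ≮⇒≥ (λ i<k → i∉P (∈-prefix⁺ i<k))

≤-before-last : ∀ {c k m} → c + 1 ≡ k → m < k → m ≤ c
≤-before-last {c} {m = m} refl m<c+1 = m<1+n⇒m≤n (subst (m <_) (+-comm c 1) m<c+1)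

≤-after-last : ∀ {c k m} → c + 1 ≡ k → k ≤ m → c ≤ m
≤-after-last {c} refl c+1≤m = ≤-trans (m≤m+n c 1) c+1≤m

last-of-prefix : ∀ {n k} → k ≤ n → 0 < k → Σ (Fin n) λ c → toℕ c + 1 ≡ k
last-of-prefix {k = suc k} k≤n _ = fromℕ< k≤n , trans (cong (_+ 1) (toℕ-fromℕ< k≤n)) (+-comm k 1)

module _ {n} (w p : Fin n → ℕ) where
  open ≤-Reasoning

  sumOver-ratio-≤ : ∀ x y (J : Subset n)
    → (∀ {i} → i ∈ J → p i * y ≤ x * w i) → sumOver p J * y ≤ x * sumOver w J
  sumOver-ratio-≤ x y J bound = begin
    sumOver p J * y            ≡⟨ *-distribʳ-sumOver y p J ⟩
    sumOver (λ i → p i * y) J  ≤⟨ sumOver-mono J bound ⟩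
    sumOver (λ i → x * w i) J  ≡⟨ *-distribˡ-sumOver x w J ⟨
    x * sumOver w J            ∎

  sumOver-ratio-≥ : ∀ x y (J : Subset n)
    → (∀ {i} → i ∈ J → x * w i ≤ p i * y) → x * sumOver w J ≤ sumOver p J * y
  sumOver-ratio-≥ x y J bound = begin
    x * sumOver w J            ≡⟨ *-distribˡ-sumOver x w J ⟩
    sumOver (λ i → x * w i) J  ≤⟨ sumOver-mono J bound ⟩
    sumOver (λ i → p i * y) J  ≡⟨ *-distribʳ-sumOver y p J ⟨
    sumOver p J * y            ∎

  module _ {In Out : Subset n} (sameWeight : sumOver w Out ≡ sumOver w In) where

    profit-≤-if-separated : (c : Fin n) → 0 < w c
      → (∀ {i} → i ∈ In → p c * w i ≤ p i * w c)
      → (∀ {j} → j ∈ Out → p j * w c ≤ p c * w j)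
      → sumOver p Out ≤ sumOver p In
    profit-≤-if-separated c 0<wc In≥c Out≤c = *-cancelʳ-≤ _ _ (w c) {{>-nonZero 0<wc}} (begin
      sumOver p Out * w c  ≤⟨ sumOver-ratio-≤ (p c) (w c) Out Out≤c ⟩
      p c * sumOver w Out  ≡⟨ cong (p c *_) sameWeight ⟩
      p c * sumOver w In   ≤⟨ sumOver-ratio-≥ (p c) (w c) In In≥c ⟩
      sumOver p In * w c   ∎)

    profit-<-if-separated : (a b : Fin n) → p b * w a < p a * w b → 0 < sumOver w In
      → (∀ {i} → i ∈ In → p a * w i ≤ p i * w a)
      → (∀ {j} → j ∈ Out → p j * w b ≤ p b * w j)
      → sumOver p Out < sumOver p In
    profit-<-if-separated a b gap 0<W In≥a Out≤b = *-cancelʳ-< (w b * w a) _ _ (begin-strict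
      sumOver p Out * (w b * w a)  ≡⟨ *-assoc (sumOver p Out) (w b) (w a) ⟨
      sumOver p Out * w b * w a    ≤⟨ *-monoˡ-≤ (w a) (sumOver-ratio-≤ (p b) (w b) Out Out≤b) ⟩
      p b * sumOver w Out * w a    ≡⟨ cong (λ W → p b * W * w a) sameWeight ⟩
      p b * W * w a                ≡⟨ m*n*o≡m*o*n (p b) W (w a) ⟩
      p b * w a * W                <⟨ *-monoˡ-< W {{>-nonZero 0<W}} gap ⟩
      p a * w b * W                ≡⟨ m*n*o≡m*o*n (p a) (w b) W ⟩
      p a * W * w b                ≤⟨ *-monoˡ-≤ (w b) (sumOver-ratio-≥ (p a) (w a) In In≥a) ⟩
      sumOver p In * w a * w b     ≡⟨ m*n*o≡m*o*n (sumOver p In) (w a) (w b) ⟩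
      sumOver p In * w b * w a     ≡⟨ *-assoc (sumOver p In) (w b) (w a) ⟩
      sumOver p In * (w b * w a)   ∎)
      where
      W : ℕ
      W = sumOver w In

argmax : ∀ {n} (f : Subset n → ℕ) → Σ (Subset n) λ Q → ∀ R → f R ≤ f Q
argmax {zero}  f = [] , λ { [] → ≤-refl }
argmax {suc n} f with argmax (λ R → f (inside ∷ R)) | argmax (λ R → f (outside ∷ R))
... | Q₁ , max₁ | Q₀ , max₀ with f (inside ∷ Q₁) ≤? f (outside ∷ Q₀)
... | yes ≤₀ = outside ∷ Q₀ , λ { (inside  ∷ R) → ≤-trans (max₁ R) ≤₀
                               ; (outside ∷ R) → max₀ R }
... | no  ≰₀ = inside ∷ Q₁ , λ { (inside  ∷ R) → max₁ R
                               ; (outside ∷ R) → ≤-trans (max₀ R) (<⇒≤ (≰⇒> ≰₀)) }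

module _ {n ℓ} {C : Pred (Subset n) ℓ} (C? : Decidable C) (f : Subset n → ℕ) where

  private
    bonus : ∀ {A : Set ℓ} → Dec A → ℕ → ℕ
    bonus (yes _) m = suc m
    bonus (no _)  _ = 0

  argmaxOn : ∃ C → Σ (Subset n) λ Q → C Q × (∀ R → C R → f R ≤ f Q)
  argmaxOn (R₀ , CR₀) = Q , CQ , maximal
    where
    Q : Subset n
    Q = proj₁ (argmax (λ R → bonus (C? R) (f R)))
    bonus≤ : ∀ R → bonus (C? R) (f R) ≤ bonus (C? Q) (f Q)
    bonus≤ = proj₂ (argmax (λ R → bonus (C? R) (f R)))

    CQ : C Q
    CQ with C? R₀ | C? Q | bonus≤ R₀
    ... | _       | yes CQ | _  = CQ
    ... | yes _   | no _   | ()
    ... | no ¬CR₀ | no _   | _  = contradiction CR₀ ¬CR₀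

    maximal : ∀ R → C R → f R ≤ f Q
    maximal R CR with C? R | C? Q | bonus≤ R
    ... | yes _  | yes _ | s≤s fR≤fQ = fR≤fQ
    ... | yes _  | no _  | ()
    ... | no ¬CR | _     | _         = contradiction CR ¬CR

optimum-maximizing : ∀ {n} (w p : Fin n → ℕ) (t : ℕ) (g : Subset n → ℕ)
  → Σ (Subset n) λ Q → Optimal w p t Q × (∀ R → Optimal w p t R → g R ≤ g Q)
optimum-maximizing w p t g
  with argmaxOn (λ R → sumOver w R ≤? t) (sumOver p) (⊥ , subst (_≤ t) (sym (sumOver-⊥ w)) z≤n)
... | Q₀ , feasible₀ , optimal₀
  with argmaxOn (λ R → (sumOver w R ≤? t) ×-dec (sumOver p Q₀ ≤? sumOver p R)) g
                (Q₀ , feasible₀ , ≤-refl)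
... | Q , (feasible , Q₀≤Q) , maximal =
  Q , (feasible , λ R feasibleR → ≤-trans (optimal₀ R feasibleR) Q₀≤Q)
    , λ R (feasibleR , optimalR) → maximal R (feasibleR , optimalR Q₀ feasible₀)

module Exchange {n} {P Q In Out : Subset n} (In⊆P─Q : In ⊆ P ─ Q) (Out⊆Q─P : Out ⊆ Q ─ P) where

  Q′ : Subset n
  Q′ = (Q ─ Out) ∪ In

  In⊆P : In ⊆ P
  In⊆P i∈In = proj₁ (x∈p─q⁻ P Q (In⊆P─Q i∈In))

  Out∩P≡∅ : ∀ {j} → j ∈ Out → j ∉ P
  Out∩P≡∅ j∈Out = proj₂ (x∈p─q⁻ Q P (Out⊆Q─P j∈Out))

  private
    sumOver-Q : ∀ f → sumOver f Q ≡ sumOver f (Q ─ Out) + sumOver f Out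
    sumOver-Q f = sumOver-─ f (λ j∈Out → proj₁ (x∈p─q⁻ Q P (Out⊆Q─P j∈Out)))

    sumOver-Q′ : ∀ f → sumOver f Q′ ≡ sumOver f (Q ─ Out) + sumOver f In
    sumOver-Q′ f = sumOver-∪ f λ i∈Q─Out i∈In →
      proj₂ (x∈p─q⁻ P Q (In⊆P─Q i∈In)) (proj₁ (x∈p─q⁻ Q Out i∈Q─Out))

  sumOver-exchange-≡ : ∀ f → sumOver f Out ≡ sumOver f In → sumOver f Q′ ≡ sumOver f Q
  sumOver-exchange-≡ f Out≡In =
    trans (sumOver-Q′ f) (trans (cong (sumOver f (Q ─ Out) +_) (sym Out≡In)) (sym (sumOver-Q f)))

  sumOver-exchange-≤ : ∀ f → sumOver f Out ≤ sumOver f In → sumOver f Q ≤ sumOver f Q′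
  sumOver-exchange-≤ f Out≤In =
    subst₂ _≤_ (sym (sumOver-Q f)) (sym (sumOver-Q′ f)) (+-monoʳ-≤ _ Out≤In)

  sumOver-exchange-< : ∀ f → sumOver f Out < sumOver f In → sumOver f Q < sumOver f Q′
  sumOver-exchange-< f Out<In =
    subst₂ _<_ (sym (sumOver-Q f)) (sym (sumOver-Q′ f)) (+-monoʳ-< _ Out<In)

  exchange-⊂ : Nonempty In → Q ∩ P ⊂ Q′ ∩ P
  exchange-⊂ (i , i∈In) = Q∩P⊆Q′∩P , i , x∈p∩q⁺ (q⊆p∪q (Q ─ Out) In i∈In , In⊆P i∈In) , i∉Q∩P
    where
    Q∩P⊆Q′∩P : Q ∩ P ⊆ Q′ ∩ P
    Q∩P⊆Q′∩P x∈Q∩P with x∈p∩q⁻ Q P x∈Q∩P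
    ... | x∈Q , x∈P = x∈p∩q⁺ (p⊆p∪q In (x∈p─q⁺ x∈Q (λ x∈Out → Out∩P≡∅ x∈Out x∈P)) , x∈P)
    i∉Q∩P : i ∉ Q ∩ P
    i∉Q∩P i∈Q∩P = proj₂ (x∈p─q⁻ P Q (In⊆P─Q i∈In)) (proj₁ (x∈p∩q⁻ Q P i∈Q∩P))

CommonSubsetSum : ∀ {n} (w : Fin n → ℕ) (I J : Subset n) → ℕ → Set
CommonSubsetSum w I J s = InSubsetSums w I s × InSubsetSums w J s

module _ {n k t : ℕ} {w p : Fin n → ℕ} (w>0 : ∀ i → 1 ≤ w i) (sorted : SortedByEfficiency w p) where

  improving-exchange : k ≤ n → ∀ {Q s} → CommonSubsetSum w (prefix k ─ Q) (Q ─ prefix k) s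
    → Σ (Subset n) λ Q′ → sumOver w Q′ ≡ sumOver w Q × sumOver p Q ≤ sumOver p Q′
                         × Q ∩ prefix k ⊂ Q′ ∩ prefix k
  improving-exchange k≤n ((In , In⊆P─Q , (i , i∈In) , wIn≡s) , (Out , Out⊆Q─P , _ , wOut≡s)) =
    Q′ , sumOver-exchange-≡ w sameWeight
       , sumOver-exchange-≤ p (profit-≤-if-separated w p sameWeight c (w>0 c) In≥c Out≤c)
       , exchange-⊂ (i , i∈In)
    where
    open Exchange In⊆P─Q Out⊆Q─P
    sameWeight : sumOver w Out ≡ sumOver w In
    sameWeight = trans wOut≡s (sym wIn≡s)
    pivot : Σ (Fin n) λ c → toℕ c + 1 ≡ k
    pivot = last-of-prefix k≤n (<-≤-trans z<s (∈-prefix⁻ (In⊆P i∈In)))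
    c : Fin n
    c = proj₁ pivot
    In≥c : ∀ {i} → i ∈ In → p c * w i ≤ p i * w c
    In≥c i∈In = sorted _ c (≤-before-last (proj₂ pivot) (∈-prefix⁻ (In⊆P i∈In)))
    Out≤c : ∀ {j} → j ∈ Out → p j * w c ≤ p c * w j
    Out≤c j∈Out = sorted c _ (≤-after-last (proj₂ pivot) (∉-prefix⁻ (Out∩P≡∅ j∈Out)))

  strictly-improving-exchange : (a b : Fin n) → toℕ a + 1 ≡ k → toℕ b ≡ k → p b * w a < p a * w b
    → ∀ {Q s} → CommonSubsetSum w (prefix k ─ Q) (Q ─ prefix k) s
    → Σ (Subset n) λ Q′ → sumOver w Q′ ≡ sumOver w Q × sumOver p Q < sumOver p Q′
  strictly-improving-exchange a b a+1≡k b≡k gap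
    ((In , In⊆P─Q , (i , i∈In) , wIn≡s) , (Out , Out⊆Q─P , _ , wOut≡s)) =
    Q′ , sumOver-exchange-≡ w sameWeight
       , sumOver-exchange-< p
           (profit-<-if-separated w p sameWeight a b gap (sumOver-pos i∈In (w>0 i)) In≥a Out≤b)
    where
    open Exchange In⊆P─Q Out⊆Q─P
    sameWeight : sumOver w Out ≡ sumOver w In
    sameWeight = trans wOut≡s (sym wIn≡s)
    In≥a : ∀ {i} → i ∈ In → p a * w i ≤ p i * w a
    In≥a i∈In = sorted _ a (≤-before-last a+1≡k (∈-prefix⁻ (In⊆P i∈In)))
    Out≤b : ∀ {j} → j ∈ Out → p j * w b ≤ p b * w j
    Out≤b j∈Out = sorted b _ (subst (_≤ toℕ _) (sym b≡k) (∉-prefix⁻ (Out∩P≡∅ j∈Out)))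

  ∃-optimal-disjointSubsetSums : k ≤ n
    → Σ (Subset n) λ Q → Optimal w p t Q × DisjointSubsetSums w (prefix k ─ Q) (Q ─ prefix k)
  ∃-optimal-disjointSubsetSums k≤n with optimum-maximizing w p t (λ R → ∣ R ∩ prefix k ∣)
  ... | Q , (feasible , optimal) , maximal = Q , (feasible , optimal) , λ s common →
    let Q′ , sameWeight , Q≤Q′ , Q⊂Q′ = improving-exchange k≤n common
        optimal′ = subst (_≤ t) (sym sameWeight) feasible
                 , λ R feasibleR → ≤-trans (optimal R feasibleR) Q≤Q′
    in <⇒≱ (p⊂q⇒∣p∣<∣q∣ Q⊂Q′) (maximal Q′ optimal′)

  optimal⇒disjointSubsetSums : (a b : Fin n) → toℕ a + 1 ≡ k → toℕ b ≡ k → p b * w a < p a * w b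
    → (Q : Subset n) → Optimal w p t Q → DisjointSubsetSums w (prefix k ─ Q) (Q ─ prefix k)
  optimal⇒disjointSubsetSums a b a+1≡k b≡k gap Q (feasible , optimal) s common =
    let Q′ , sameWeight , Q<Q′ = strictly-improving-exchange a b a+1≡k b≡k gap common
    in <⇒≱ Q<Q′ (optimal Q′ (subst (_≤ t) (sym sameWeight) feasible))

lemma3p1 : (n : ℕ) (t : ℕ) (w p : Fin n → ℕ) → 1 ≤ t
    → (∀ i → 1 ≤ w i) → (∀ i → 1 ≤ p i)
    → SortedByEfficiency w p
    → (∀ i → w i ≤ t) → t < sumOver w ⊤
    → (k : ℕ) → IsIStar w t k
    → (Σ (Subset n) λ Q → Optimal w p t Q
         × DisjointSubsetSums w (prefix k ─ Q) (Q ─ prefix k))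
      × ((a b : Fin n) → toℕ a + 1 ≡ k → toℕ b ≡ k → p b * w a < p a * w b
         → (Q : Subset n) → Optimal w p t Q
         → DisjointSubsetSums w (prefix k ─ Q) (Q ─ prefix k))
lemma3p1 n t w p _ w>0 _ sorted _ _ k (k≤n , _) =
  ∃-optimal-disjointSubsetSums w>0 sorted k≤n , optimal⇒disjointSubsetSums w>0 sorted
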